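{- The Baire space $\omega^\omega$ is a $\tau$-space.
   Context: For a space $X$ (zero-dimensional separable metrizable) and a sequence $\langle G_n:n<\omega\rangle$ of open subsets of $X$: it is a $\gamma$-sequence for $X$ if every $x\in X$ lies in $G_n$ for all but finitely many $n$; it is a $\tau$-sequence for $X$ if (i) every $x\in X$ lies in $G_n$ for infinitely many $n$, and (ii) for all $x,y\in X$, either for all but finitely many $n$ ($x\in G_n\Rightarrow y\in G_n$), or for all but finitely many $n$ ($y\in G_n\Rightarrow x\in G_n$). An open cover $\mathcal U$ of $X$ is a $\gamma$-cover (resp. $\tau$-cover) of $X$ if some sequence of elements of $\mathcal U$ is a $\gamma$-sequence (resp. $\tau$-sequence) for $X$. $X$ is a $\tau$-space if every cover of $X$ by clopen sets which is a $\tau$-cover of $X$ is a $\gamma$-cover of $X$. -}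

module Defs where

open import Level using (0ℓ) renaming (suc to lsuc)
open import Data.Nat using (ℕ; _≤_; _<_)
open import Data.Product using (Σ; ∃; _×_)
open import Data.Sum using (_⊎_)
open import Relation.Nullary using (¬_)
open import Relation.Binary.PropositionalEquality using (_≡_)
open import Axiom.ExcludedMiddle using (ExcludedMiddle)

-- Classical logic (the paper works in ordinary classical mathematics).
Classical : Set (lsuc (lsuc 0ℓ))
Classical = ExcludedMiddle 0ℓ × ExcludedMiddle (lsuc 0ℓ)

Baire : Set
Baire = ℕ → ℕ

Subset : Set₁
Subset = Baire → Set

AgreeUpTo : ℕ → Baire → Baire → Set
AgreeUpTo n x y = ∀ i → i < n → x i ≡ y i

IsOpen : Subset → Set
IsOpen U = ∀ x → U x → ∃ λ n → ∀ y → AgreeUpTo n x y → U y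

Complement : Subset → Subset
Complement U x = ¬ U x

IsClopen : Subset → Set
IsClopen U = IsOpen U × IsOpen (Complement U)

AllButFinitely : (ℕ → Set) → Set
AllButFinitely P = ∃ λ N → ∀ n → N ≤ n → P n

InfinitelyMany : (ℕ → Set) → Set
InfinitelyMany P = ∀ N → ∃ λ n → N ≤ n × P n

IsγSequence : (ℕ → Subset) → Set
IsγSequence G = ∀ x → AllButFinitely (λ n → G n x)

IsτSequence : (ℕ → Subset) → Set
IsτSequence G =
  (∀ x → InfinitelyMany (λ n → G n x)) ×
  (∀ x y → AllButFinitely (λ n → G n x → G n y)
         ⊎ AllButFinitely (λ n → G n y → G n x))

Family : Set₂
Family = Subset → Set₁

IsOpenCover : Family → Set₁
IsOpenCover 𝒰 = (∀ U → 𝒰 U → IsOpen U) × (∀ x → Σ Subset λ U → 𝒰 U × U x)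

IsClopenCover : Family → Set₁
IsClopenCover 𝒰 = (∀ U → 𝒰 U → IsClopen U) × (∀ x → Σ Subset λ U → 𝒰 U × U x)

IsγCover : Family → Set₁
IsγCover 𝒰 = IsOpenCover 𝒰 × Σ (ℕ → Subset) λ G → (∀ n → 𝒰 (G n)) × IsγSequence G

IsτCover : Family → Set₁
IsτCover 𝒰 = IsOpenCover 𝒰 × Σ (ℕ → Subset) λ G → (∀ n → 𝒰 (G n)) × IsτSequence G

BaireIsτSpace : Set₂
BaireIsτSpace = ∀ (𝒰 : Family) → IsClopenCover 𝒰 → IsτCover 𝒰 → IsγCover 𝒰

{-# OPTIONS --safe #-}
module Submission where

open import Defs
open import Level using (0ℓ)
open import Function using (_∘_)
open import Data.Nat using (ℕ; zero; suc; _≤_; _<_; _+_; _≤′_; ≤′-refl; ≤′-step; _⊔_; z≤n; s≤s)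
open import Data.Nat.Properties
  using (≤-refl; ≤-trans; ≤-reflexive; ≤-total; ≤-pred; <-≤-trans; ≤⇒≤′; m≤n⇒m<n∨m≡n;
         m+n≤o⇒m≤o; m+n≤o⇒n≤o; m≤m⊔n; m≤n⊔m; m≤n⇒m≤o⊔n)
open import Data.Nat.Binary using (ℕᵇ; zero; 2[1+_]; 1+[2_]; fromℕ; toℕ)
open import Data.Nat.Binary.Properties using (fromℕ-toℕ)
open import Data.List using (List; []; _∷_; length; applyUpTo)
open import Data.List.Properties using (length-applyUpTo)
open import Data.Product using (Σ; ∃; ∃₂; _×_; _,_; proj₁; proj₂)
open import Data.Sum using (_⊎_; inj₁; inj₂; [_,_])
open import Data.Empty using (⊥; ⊥-elim)
open import Relation.Nullary using (¬_; yes; no)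
open import Relation.Binary.PropositionalEquality using (_≡_; refl; sym; trans; cong; subst)
open import Axiom.ExcludedMiddle using (ExcludedMiddle)
open import Axiom.DoubleNegationElimination using (DoubleNegationElimination; em⇒dne)

-- Write x ≼ y when eventually x ∈ G n implies y ∈ G n; for a τ-sequence this is a
-- total preorder. If it has a countable coinitial set {c k}, then c 0, …, c k have a
-- ≼-least element, which lies in some G n with n ≥ k beyond the point where it is
-- below all of them; these G n form a γ-sequence. Otherwise, choosing for every basic
-- open set [s] that is not coinitial a point z s with nothing of [s] below it, a point
-- p above none of the countably many z s has the property that all neighbourhoods of
-- points below p are coinitial. Such neighbourhoods always contain points that are
-- not above a given one, so clopenness yields a Cantor scheme whose two branches
-- converge to points x and w with x ∈ G n ∌ w and w ∈ G n ∌ x for infinitely many n,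
-- contradicting totality.

incrementHead : List ℕ → List ℕ
incrementHead []      = []
incrementHead (a ∷ u) = suc a ∷ u

listOfBits : ℕᵇ → List ℕ
listOfBits zero      = []
listOfBits 1+[2 n ]  = 0 ∷ listOfBits n
listOfBits 2[1+ n ]  = incrementHead (listOfBits n)

listOfBits-surjective : ∀ u → ∃ λ n → listOfBits n ≡ u
listOfBits-surjective-∷ : ∀ a u → ∃ λ n → listOfBits n ≡ a ∷ u

listOfBits-surjective []      = zero , refl
listOfBits-surjective (a ∷ u) = listOfBits-surjective-∷ a u

listOfBits-surjective-∷ zero u with listOfBits-surjective u
... | n , refl = 1+[2 n ] , refl
listOfBits-surjective-∷ (suc a) u with listOfBits-surjective-∷ a u
... | n , eq = 2[1+ n ] , cong incrementHead eq

enumList : ℕ → List ℕ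
enumList = listOfBits ∘ fromℕ

enumList-surjective : ∀ u → ∃ λ n → enumList n ≡ u
enumList-surjective u with listOfBits-surjective u
... | n , refl = toℕ n , cong listOfBits (fromℕ-toℕ n)

agree-refl : ∀ {k x} → AgreeUpTo k x x
agree-refl _ _ = refl

agree-mono : ∀ {k k' x y} → k ≤ k' → AgreeUpTo k' x y → AgreeUpTo k x y
agree-mono k≤k' x≈y i i<k = x≈y i (<-≤-trans i<k k≤k')

pad : List ℕ → Baire
pad []      _       = 0
pad (a ∷ u) zero    = a
pad (a ∷ u) (suc i) = pad u i

pad-applyUpTo : ∀ x k → AgreeUpTo k (pad (applyUpTo x k)) x
pad-applyUpTo x (suc k) zero    _         = refl
pad-applyUpTo x (suc k) (suc i) (s≤s i<k) = pad-applyUpTo (x ∘ suc) k i i<k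

record Ball : Set where
  constructor ball
  field
    centre : Baire
    depth  : ℕ
open Ball

infix 4 _∈ᴮ_ _⊑_

_∈ᴮ_ : Baire → Ball → Set
y ∈ᴮ b = AgreeUpTo (depth b) (centre b) y

_⊑_ : Ball → Ball → Set
b' ⊑ b = depth b ≤ depth b' × centre b' ∈ᴮ b

∈-⊑ : ∀ {b b' y} → b' ⊑ b → y ∈ᴮ b' → y ∈ᴮ b
∈-⊑ (d≤d' , c'∈b) y∈b' i i<d = trans (c'∈b i i<d) (y∈b' i (<-≤-trans i<d d≤d'))

⊑-refl : ∀ {b} → b ⊑ b
⊑-refl = ≤-refl , agree-refl

⊑-trans : ∀ {b b' b''} → b'' ⊑ b' → b' ⊑ b → b'' ⊑ b
⊑-trans (d'≤d'' , c''∈b') b'⊑b = ≤-trans (proj₁ b'⊑b) d'≤d'' , ∈-⊑ b'⊑b c''∈b'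

ballOf : List ℕ → Ball
ballOf u = ball (pad u) (length u)

ballOf-applyUpTo : ∀ x k → ballOf (applyUpTo x k) ⊑ ball x k × ball x k ⊑ ballOf (applyUpTo x k)
ballOf-applyUpTo x k =
  (≤-reflexive (sym |u|≡k) , λ i i<k → sym (pad-applyUpTo x k i i<k)) ,
  (≤-reflexive |u|≡k , subst (λ d → AgreeUpTo d (pad (applyUpTo x k)) x) (sym |u|≡k) (pad-applyUpTo x k))
  where
  |u|≡k : length (applyUpTo x k) ≡ k
  |u|≡k = length-applyUpTo x k

module Nested (F : ℕ → Ball) (shrinking : ∀ m → F (suc m) ⊑ F m) where

  ⊑-descending : ∀ {m n} → m ≤ n → F n ⊑ F m
  ⊑-descending m≤n = go (≤⇒≤′ m≤n)
    where
    go : ∀ {m n} → m ≤′ n → F n ⊑ F m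
    go ≤′-refl      = ⊑-refl
    go (≤′-step m≤n) = ⊑-trans (shrinking _) (go m≤n)

  intersection : (∀ m → m < depth (F (suc m))) → ∃ λ x → ∀ m → x ∈ᴮ F m
  intersection deep = x , x∈F
    where
    x : Baire
    x i = centre (F (suc i)) i
    x∈F : ∀ m → x ∈ᴮ F m
    x∈F m i i<d with ≤-total m (suc i)
    ... | inj₁ m≤1+i = proj₂ (⊑-descending m≤1+i) i i<d
    ... | inj₂ 1+i≤m = sym (proj₂ (⊑-descending 1+i≤m) i (deep i))

module Eventually {X : Set} (G : ℕ → X → Set) where

  private variable
    x y z : X
    N N'  : ℕ
    S S'  : X → Set

  infix 4 _≼[_]_ _≼_ _⋠_

  _≼[_]_ : X → ℕ → X → Set
  x ≼[ N ] y = ∀ n → N ≤ n → G n x → G n y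

  _≼_ : X → X → Set
  x ≼ y = AllButFinitely (λ n → G n x → G n y)

  _⋠_ : X → X → Set
  x ⋠ y = InfinitelyMany (λ n → G n x × ¬ G n y)

  ≼[]-refl : ∀ x → x ≼[ N ] x
  ≼[]-refl x _ _ gx = gx

  ≼[]-trans : x ≼[ N ] y → y ≼[ N ] z → x ≼[ N ] z
  ≼[]-trans x≼y y≼z n N≤n = y≼z n N≤n ∘ x≼y n N≤n

  ≼[]-mono : N ≤ N' → x ≼[ N ] y → x ≼[ N' ] y
  ≼[]-mono N≤N' x≼y n N'≤n = x≼y n (≤-trans N≤N' N'≤n)

  ≼-refl : x ≼ x
  ≼-refl = 0 , ≼[]-refl _

  ≼-trans : x ≼ y → y ≼ z → x ≼ z
  ≼-trans (N , x≼y) (N' , y≼z) =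
    N ⊔ N' , ≼[]-trans (≼[]-mono (m≤m⊔n N N') x≼y) (≼[]-mono (m≤n⊔m N N') y≼z)

  ⋠⇒¬≼ : x ⋠ y → ¬ x ≼ y
  ⋠⇒¬≼ x⋠y (N , x≼y) with x⋠y N
  ... | n , N≤n , gx , ¬gy = ¬gy (x≼y n N≤n gx)

  Total : Set
  Total = ∀ x y → x ≼ y ⊎ y ≼ x

  Coinitial : (X → Set) → Set
  Coinitial S = ∀ y → ∃ λ x → S x × x ≼ y

  CoinitialSequence : (ℕ → X) → Set
  CoinitialSequence c = Coinitial (λ x → ∃ λ k → c k ≡ x)

  coinitial-mono : (∀ {x} → S x → S' x) → Coinitial S → Coinitial S'
  coinitial-mono S⊆S' coinitial y with coinitial y
  ... | x , Sx , x≼y = x , S⊆S' Sx , x≼y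

  module _ (total : Total) where

    lowerBound₂ : ∀ x y → ∃₂ λ z N → z ≼[ N ] x × z ≼[ N ] y
    lowerBound₂ x y with total x y
    ... | inj₁ (N , x≼y) = x , N , ≼[]-refl x , x≼y
    ... | inj₂ (N , y≼x) = y , N , y≼x , ≼[]-refl y

    lowerBound : (c : ℕ → X) → ∀ k → ∃₂ λ z N → ∀ i → i ≤ k → z ≼[ N ] c i
    lowerBound c zero = c 0 , 0 , λ { _ z≤n → ≼[]-refl (c 0) }
    lowerBound c (suc k) with lowerBound c k
    ... | z , N , z≼c with lowerBound₂ z (c (suc k))
    ... | z' , N' , z'≼z , z'≼c₁₊ₖ = z' , N ⊔ N' , z'≼c
      where
      z'≼c : ∀ i → i ≤ suc k → z' ≼[ N ⊔ N' ] c i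
      z'≼c i i≤1+k with m≤n⇒m<n∨m≡n i≤1+k
      ... | inj₁ i<1+k = ≼[]-trans (≼[]-mono (m≤n⊔m N N') z'≼z)
                                   (≼[]-mono (m≤m⊔n N N') (z≼c i (≤-pred i<1+k)))
      ... | inj₂ refl  = ≼[]-mono (m≤n⊔m N N') z'≼c₁₊ₖ

    module _ (infinitely : ∀ x → InfinitelyMany (λ n → G n x)) where

      commonMember : (c : ℕ → X) → ∀ k → ∃ λ n → k ≤ n × (∀ i → i ≤ k → G n (c i))
      commonMember c k with lowerBound c k
      ... | z , N , z≼c with infinitely z (N + k)
      ... | n , N+k≤n , gz =
        n , m+n≤o⇒n≤o N N+k≤n , λ i i≤k → z≼c i i≤k n (m+n≤o⇒m≤o N N+k≤n) gz

      γ-subsequence : ∀ {c} → CoinitialSequence c →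
                      ∃ λ (b : ℕ → ℕ) → ∀ x → AllButFinitely (λ n → G (b n) x)
      γ-subsequence {c} coinitial = b , eventually
        where
        b : ℕ → ℕ
        b k = proj₁ (commonMember c k)
        eventually : ∀ x → AllButFinitely (λ n → G (b n) x)
        eventually x with coinitial x
        ... | _ , (k , refl) , N , cₖ≼x = k + N , λ n k+N≤n →
          let (_ , n≤bₙ , c⊆Gbₙ) = commonMember c n
          in cₖ≼x (b n) (≤-trans (m+n≤o⇒n≤o k k+N≤n) n≤bₙ) (c⊆Gbₙ k (m+n≤o⇒m≤o k k+N≤n))

  module _ (dne : DoubleNegationElimination 0ℓ) where

    ¬≼⇒⋠ : ¬ x ≼ y → x ⋠ y
    ¬≼⇒⋠ ¬x≼y N = dne λ none → ¬x≼y (N , λ n N≤n gx → dne λ ¬gy → none (n , N≤n , gx , ¬gy))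

    ¬coinitial⇒bound : ¬ Coinitial S → ∃ λ z → ∀ x → S x → ¬ x ≼ z
    ¬coinitial⇒bound ¬coinitial =
      dne λ none → ¬coinitial λ y → dne λ ¬below → none (y , λ x Sx x≼y → ¬below (x , Sx , x≼y))

module ClopenSequence (em : ExcludedMiddle 0ℓ) (G : ℕ → Subset) (clopen : ∀ n → IsClopen (G n)) where

  open Eventually G

  private
    dne : DoubleNegationElimination 0ℓ
    dne = em⇒dne em

  Separated : ℕ → Ball → Ball → Set
  Separated M a b = ∃ λ n → M ≤ n × (∀ y → y ∈ᴮ a → G n y) × (∀ y → y ∈ᴮ b → ¬ G n y)

  separated-⊑ : ∀ {M a b a' b'} → Separated M a b → a' ⊑ a → b' ⊑ b → Separated M a' b'
  separated-⊑ (n , M≤n , a⊆G , b∩G≡∅) a'⊑a b'⊑b =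
    n , M≤n , (λ y → a⊆G y ∘ ∈-⊑ a'⊑a) , (λ y → b∩G≡∅ y ∘ ∈-⊑ b'⊑b)

  separated-points : ∀ {M a b x y} → Separated M a b → x ∈ᴮ a → y ∈ᴮ b →
                     ∃ λ n → M ≤ n × G n x × ¬ G n y
  separated-points (n , M≤n , a⊆G , b∩G≡∅) x∈a y∈b = n , M≤n , a⊆G _ x∈a , b∩G≡∅ _ y∈b

  module _ (total : Total) (notCountablyCoinitial : ∀ c → ¬ CoinitialSequence c) where

    noMinimum : ∀ x → ∃ λ z → ¬ x ≼ z
    noMinimum x with ¬coinitial⇒bound dne (notCountablyCoinitial λ _ → x)
    ... | z , nothing≼z = z , nothing≼z x (0 , refl)

    bound : (b : Ball) → Σ Baire λ z → ¬ Coinitial (_∈ᴮ b) → ∀ x → x ∈ᴮ b → ¬ x ≼ z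
    bound b with em {Coinitial (_∈ᴮ b)}
    ... | yes coinitial  = centre b , λ ¬coinitial → ⊥-elim (¬coinitial coinitial)
    ... | no ¬coinitial = let (z , nothing≼z) = ¬coinitial⇒bound dne ¬coinitial in z , λ _ → nothing≼z

    ∃pivot : ∃ λ p → ∀ x → (∃ λ k → proj₁ (bound (ballOf (enumList k))) ≡ x) → ¬ x ≼ p
    ∃pivot = ¬coinitial⇒bound dne (notCountablyCoinitial λ k → proj₁ (bound (ballOf (enumList k))))

    pivot : Baire
    pivot = proj₁ ∃pivot

    ¬bound≼pivot : ∀ u → ¬ proj₁ (bound (ballOf u)) ≼ pivot
    ¬bound≼pivot u with enumList-surjective u
    ... | k , refl = proj₂ ∃pivot _ (k , refl)

    -- ball w k is also a ball ballOf u of the enumerated family; the bound chosen for it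
    -- is not below the pivot, so it is above the pivot and hence above w ∈ ballOf u.
    coinitial-below-pivot : ∀ {w} → w ≼ pivot → ∀ k → Coinitial (_∈ᴮ ball w k)
    coinitial-below-pivot {w} w≼pivot k =
      coinitial-mono (∈-⊑ (proj₁ (ballOf-applyUpTo w k))) (dne ¬¬coinitial)
      where
      u : List ℕ
      u = applyUpTo w k
      ¬¬coinitial : ¬ ¬ Coinitial (_∈ᴮ ballOf u)
      ¬¬coinitial ¬coinitial with total (proj₁ (bound (ballOf u))) pivot
      ... | inj₁ z≼pivot = ¬bound≼pivot u z≼pivot
      ... | inj₂ pivot≼z = proj₂ (bound (ballOf u)) ¬coinitial w
                             (∈-⊑ (proj₂ (ballOf-applyUpTo w k)) agree-refl) (≼-trans w≼pivot pivot≼z)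

    escape : ∀ x {w} → w ≼ pivot → ∀ k → ∃ λ w' → w' ∈ᴮ ball w k × w' ≼ pivot × ¬ x ≼ w'
    escape x w≼pivot k with noMinimum x
    ... | z , ¬x≼z with lowerBound₂ total z pivot
    ... | y , N , y≼z , y≼pivot with coinitial-below-pivot w≼pivot k y
    ... | w' , w'∈ , w'≼y =
      w' , w'∈ , ≼-trans w'≼y (N , y≼pivot) , λ x≼w' → ¬x≼z (≼-trans x≼w' (≼-trans w'≼y (N , y≼z)))

    record Stage : Set where
      constructor stage
      field
        left right  : Baire
        level       : ℕ
        left≼pivot  : left ≼ pivot
        right≼pivot : right ≼ pivot
    open Stage

    L R : Stage → Ball
    L s = ball (left s) (level s)
    R s = ball (right s) (level s)

    swap : Stage → Stage
    swap s = stage (right s) (left s) (level s) (right≼pivot s) (left≼pivot s)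

    Refines : ℕ → Stage → Stage → Set
    Refines M s' s = L s' ⊑ L s × R s' ⊑ R s × M < level s'

    opaque
      separate : (s : Stage) → ∀ M → Σ Stage λ s' → Refines M s' s × Separated M (L s') (R s')
      separate (stage x w k x≼pivot w≼pivot) M with escape x w≼pivot k
      ... | w' , w'∈ , w'≼pivot , ¬x≼w' with ¬≼⇒⋠ dne ¬x≼w' M
      ... | n , M≤n , gx , ¬gw' with proj₁ (clopen n) x gx | proj₂ (clopen n) w' ¬gw'
      ... | i , near-x⊆G | j , near-w'∩G≡∅ =
        stage x w' k' x≼pivot w'≼pivot ,
        ((k≤k' , agree-refl) , (k≤k' , w'∈) , M<k') ,
        n , M≤n , (λ y → near-x⊆G y ∘ agree-mono i≤k') , (λ y → near-w'∩G≡∅ y ∘ agree-mono j≤k')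
        where
        k' : ℕ
        k' = suc M ⊔ (k ⊔ (i ⊔ j))
        M<k' : M < k'
        M<k' = m≤m⊔n (suc M) (k ⊔ (i ⊔ j))
        k≤k' : k ≤ k'
        k≤k' = m≤n⇒m≤o⊔n (suc M) (m≤m⊔n k _)
        i≤k' : i ≤ k'
        i≤k' = m≤n⇒m≤o⊔n (suc M) (m≤n⇒m≤o⊔n k (m≤m⊔n i j))
        j≤k' : j ≤ k'
        j≤k' = m≤n⇒m≤o⊔n (suc M) (m≤n⇒m≤o⊔n k (m≤n⊔m i j))

    step : (s : Stage) → ∀ M → Σ Stage λ s' →
           Refines M s' s × Separated M (L s') (R s') × Separated M (R s') (L s')
    step s M with separate s M
    ... | s₁ , (L₁⊑L , R₁⊑R , _) , sep₁ with separate (swap s₁) M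
    ... | s₂ , (L₂⊑R₁ , R₂⊑L₁ , M<k₂) , sep₂ =
      swap s₂ , (⊑-trans R₂⊑L₁ L₁⊑L , ⊑-trans L₂⊑R₁ R₁⊑R , M<k₂) , separated-⊑ sep₁ R₂⊑L₁ L₂⊑R₁ , sep₂

    stages : ℕ → Stage
    stages zero    = stage pivot pivot 0 ≼-refl ≼-refl
    stages (suc m) = proj₁ (step (stages m) m)

    refines : ∀ m → Refines m (stages (suc m)) (stages m)
    refines m = proj₁ (proj₂ (step (stages m) m))

    separated : ∀ m → Separated m (L (stages (suc m))) (R (stages (suc m)))
                    × Separated m (R (stages (suc m))) (L (stages (suc m)))
    separated m = proj₂ (proj₂ (step (stages m) m))

    contradiction : ⊥
    contradiction with Nested.intersection (L ∘ stages) (proj₁ ∘ refines) (proj₂ ∘ proj₂ ∘ refines)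
                     | Nested.intersection (R ∘ stages) (proj₁ ∘ proj₂ ∘ refines) (proj₂ ∘ proj₂ ∘ refines)
    ... | x , x∈L | w , w∈R = [ ⋠⇒¬≼ x⋠w , ⋠⇒¬≼ w⋠x ] (total x w)
      where
      x⋠w : x ⋠ w
      x⋠w N = separated-points (proj₁ (separated N)) (x∈L (suc N)) (w∈R (suc N))
      w⋠x : w ⋠ x
      w⋠x N = separated-points (proj₂ (separated N)) (w∈R (suc N)) (x∈L (suc N))

  countablyCoinitial : Total → ∃ CoinitialSequence
  countablyCoinitial total = dne λ none → contradiction total λ c coinitial → none (c , coinitial)

mainTheorem5 : Classical → BaireIsτSpace
mainTheorem5 (em , _) 𝒰 (clopenCover , covers) (_ , G , G∈𝒰 , infinitely , total) =
  let (_ , coinitial) = ClopenSequence.countablyCoinitial em G clopen total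
      (b , γ) = Eventually.γ-subsequence G total infinitely coinitial
  in ((λ U U∈𝒰 → proj₁ (clopenCover U U∈𝒰)) , covers) , G ∘ b , G∈𝒰 ∘ b , γ
  where
  clopen : ∀ n → IsClopen (G n)
  clopen n = clopenCover (G n) (G∈𝒰 n)
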